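{- For every positive integer $n$, \[ \sum_{k=0}^{n-1}\frac{\mathbb{F}_{k}}{k+1}=H_{n}\,\mathbb{F}_{n}-\sum_{k=0}^{n-1}\frac{H_{k+1}}{F_{k+1}}. \]
   Context: $F_n$ denotes the Fibonacci numbers: $F_0=0$, $F_1=1$, $F_{n+2}=F_{n+1}+F_n$. The $n$-th harmonic Fibonacci number is $\mathbb{F}_{n}=\sum_{k=1}^{n}\frac{1}{F_{k}}$ for $n\ge 1$, with $\mathbb{F}_0=0$. $H_n=\sum_{k=1}^n\frac1k$ is the $n$-th harmonic number, $H_0=0$. -}

module Defs where

open import Data.Nat using (ℕ; zero; suc; NonZero; nonZero) renaming (_+_ to _+ℕ_)
open import Data.Integer using (+_)
open import Data.Rational using (ℚ; _+_; _/_; 0ℚ)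

F : ℕ → ℕ
F zero = 0
F (suc zero) = 1
F (suc (suc n)) = F (suc n) +ℕ F n

F-suc-nonZero : ∀ k → NonZero (F (suc k))
F-suc-nonZero zero = nonZero
F-suc-nonZero (suc zero) = nonZero
F-suc-nonZero (suc (suc k)) with F (suc (suc k)) | F-suc-nonZero (suc k)
... | suc m | _ = nonZero

Σ< : ℕ → (ℕ → ℚ) → ℚ
Σ< zero f = 0ℚ
Σ< (suc n) f = Σ< n f + f n

H : ℕ → ℚ
H n = Σ< n (λ k → (+ 1) / suc k)

invFsuc : ℕ → ℚ
invFsuc k = _/_ (+ 1) (F (suc k)) {{F-suc-nonZero k}}

-- harmonic Fibonacci number 𝔽 n = Σ_{k=1}^n 1/F_k  (𝔽 0 = 0)
HF : ℕ → ℚ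
HF n = Σ< n invFsuc

{-# OPTIONS --safe #-}
-- Abel summation: with A, B the partial sums of a, b, one has
-- Σ_{k<n} B_k a_k = A_n B_n − Σ_{k<n} A_{k+1} b_k, since both sides grow by B_n a_n
-- when n increases. H and 𝔽 are the partial sums of 1/(k+1) and 1/F_{k+1}.
module Submission where

open import Defs
open import Data.Nat using (ℕ; zero; suc; _≤_)
open import Data.Integer using (+_)
open import Data.Rational using (ℚ; _+_; _-_; _*_; _/_)
open import Data.Rational.Solver using (module +-*-Solver)
open import Relation.Binary.PropositionalEquality using (_≡_; refl; cong)
open import Relation.Binary.PropositionalEquality.Properties using (module ≡-Reasoning)

abel-step : ∀ (A B S a b : ℚ) →
  (A * B - S) + B * a ≡ (A + a) * (B + b) - (S + (A + a) * b)
abel-step = solve 5 (λ A B S a b →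
    (A :* B :- S) :+ B :* a := (A :+ a) :* (B :+ b) :- (S :+ (A :+ a) :* b)) refl
  where open +-*-Solver

Σ<-summation-by-parts : (a b : ℕ → ℚ) (n : ℕ) →
  Σ< n (λ k → Σ< k b * a k) ≡ Σ< n a * Σ< n b - Σ< n (λ k → Σ< (suc k) a * b k)
Σ<-summation-by-parts a b zero = refl
Σ<-summation-by-parts a b (suc n) = begin
  Σ< n (λ k → Σ< k b * a k) + Σ< n b * a n
    ≡⟨ cong (_+ Σ< n b * a n) (Σ<-summation-by-parts a b n) ⟩
  (Σ< n a * Σ< n b - Σ< n (λ k → Σ< (suc k) a * b k)) + Σ< n b * a n
    ≡⟨ abel-step (Σ< n a) (Σ< n b) (Σ< n (λ k → Σ< (suc k) a * b k)) (a n) (b n) ⟩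
  Σ< (suc n) a * Σ< (suc n) b - Σ< (suc n) (λ k → Σ< (suc k) a * b k) ∎
  where open ≡-Reasoning

-- The identity also holds for n = 0.
mainTheorem5 : (n : ℕ) → 1 ≤ n →
    Σ< n (λ k → HF k * ((+ 1) / suc k)) ≡ H n * HF n - Σ< n (λ k → H (suc k) * invFsuc k)
mainTheorem5 n _ = Σ<-summation-by-parts (λ k → (+ 1) / suc k) invFsuc n
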